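{- Let $K \geq 2$ be an integer. A permutation $\sigma \in S_{K+1}$ with exactly one descent does not belong to $\mathcal{C}(K)$ if and only if $\sigma$ does not start with $1$ (i.e. $\sigma_1 \neq 1$) and does not end with $K+1$ (i.e. $\sigma_{K+1} \neq K+1$).
   Context: Permutations of size $n$ are words $\sigma_1\sigma_2\ldots\sigma_n$ containing each of $1,\ldots,n$ exactly once. A descent of $\sigma$ is a position $i \in [1..n-1]$ with $\sigma_i > \sigma_{i+1}$. A duplication-loss step of width $k$ applied to a permutation $\pi = \pi_1\ldots\pi_n$ chooses a contiguous fragment $\pi_a \pi_{a+1}\ldots\pi_{a+k-1}$ of $k$ consecutive positions and a subset $S$ of the entries of this fragment, and replaces the fragment by the entries of $S$ in their original relative order followed by the remaining entries of the fragment in their original relative order (this models tandem duplication of the fragment followed by loss of one of the two copies of each duplicated entry; $S$ is the set of entries kept in the first copy). $\mathcal{C}(K)$ denotes the class of all permutations (of any size $n$) obtained from the identity $12\ldots n$ by one duplication-loss step of width at most $K$. -}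

module Defs where

open import Data.Nat using (ℕ; zero; suc; _+_; _≤_; _<ᵇ_)
open import Data.Bool using (Bool; true; false; not; if_then_else_)
open import Data.List using (List; []; _∷_; _++_; length; map; upTo)
open import Data.Product using (Σ; ∃; _×_; _,_)
open import Relation.Binary.PropositionalEquality using (_≡_)

identity : ℕ → List ℕ
identity n = map suc (upTo n)

descents : List ℕ → ℕ
descents []            = 0
descents (x ∷ [])      = 0
descents (x ∷ y ∷ xs)  = (if y <ᵇ x then 1 else 0) + descents (y ∷ xs)

select : {A : Set} → List Bool → List A → List A
select []           _        = []
select (_ ∷ _)      []       = []
select (true ∷ bs)  (x ∷ xs) = x ∷ select bs xs
select (false ∷ bs) (x ∷ xs) = select bs xs

-- One duplication-loss step of width at most K transforms π into σ:
-- π = pre ++ frag ++ suf with |frag| ≤ K, a subset S of the fragment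
-- (given as a Boolean mask over its positions), and
-- σ = pre ++ (S-entries of frag) ++ (remaining entries of frag) ++ suf.
DLStep : ℕ → List ℕ → List ℕ → Set
DLStep K π σ =
  Σ (List ℕ) λ pre → Σ (List ℕ) λ frag → Σ (List ℕ) λ suf → Σ (List Bool) λ mask →
    (π ≡ pre ++ frag ++ suf) × (length frag ≤ K) × (length mask ≡ length frag) ×
    (σ ≡ pre ++ select mask frag ++ select (map not mask) frag ++ suf)

InC : ℕ → List ℕ → Set
InC K σ = DLStep K (identity (length σ)) σ

-- A permutation with exactly one descent is the concatenation A ++ B of two
-- increasing runs, and a sorted list xs with A ++ B ↭ xs is an interleaving of
-- A and B: some mask selects A from xs and its complement selects B. So if σ
-- starts with 1, then σ = 1 ∷ (A ++ B) arises by one step on the fragment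
-- 2 … K+1 of width K, with that mask; symmetrically if σ ends with K+1.
-- Conversely a fragment of width at most K cannot cover all K+1 positions, so a
-- step leaves the first or the last entry of the identity in place.
module Submission where

open import Defs
open import Data.Nat using (ℕ; suc; _≤_; _<_; _<ᵇ_; z≤n; s≤s⁻¹)
open import Data.Nat.Properties
  using ( _≤?_; ≤-refl; ≤-antisym; ≤-trans; ≤-reflexive; ≤⇒≯; ≰⇒>; ≮⇒≥; <⇒<ᵇ
        ; n≤1+n; 1+n≢0; n≤0⇒n≡0; m≤n+m; +-monoʳ-≤; suc-injective)
open import Data.Bool using (true; false; not; if_then_else_)
open import Data.List using (List; []; _∷_; _++_; _∷ʳ_; [_]; length; map; upTo; head; last)
open import Data.List.Properties using (length-map; length-upTo; map-++; upTo-∷ʳ; ++-identityʳ; ++-assoc)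
open import Data.List.Membership.Propositional using (_∈_)
open import Data.List.Membership.Propositional.Properties using (∈-++⁺ʳ; ∈-++⁻)
open import Data.List.Relation.Unary.All as All using ()
open import Data.List.Relation.Unary.Any using (here; there)
open import Data.List.Relation.Unary.AllPairs using (AllPairs; []; _∷_)
open import Data.List.Relation.Unary.AllPairs.Properties using (drop⁺)
open import Data.List.Relation.Unary.Linked using (Linked; []; [-]; _∷_)
open import Data.List.Relation.Unary.Linked.Properties using (Linked⇒AllPairs; map⁺; applyUpTo⁺₂)
open import Data.List.Relation.Binary.Permutation.Propositional using (_↭_; ↭-sym)
open import Data.List.Relation.Binary.Permutation.Propositional.Properties
  using (↭-empty-inv; ∈-resp-↭; ↭-length; drop-∷; drop-mid)
open import Data.Maybe using (just)
open import Data.Product using (∃; ∃₂; _×_; _,_)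
open import Data.Sum using (_⊎_; inj₁; inj₂)
open import Data.Empty using (⊥-elim)
open import Function using (_∘_; case_of_)
open import Function.Bundles using (_⇔_; mk⇔)
open import Relation.Nullary using (¬_; yes; no)
open import Relation.Binary.PropositionalEquality
  using (_≡_; _≢_; refl; sym; trans; cong; subst; subst₂; module ≡-Reasoning)

Sorted : List ℕ → Set
Sorted = AllPairs _≤_

head≤ : ∀ {x xs y} → Sorted (x ∷ xs) → y ∈ x ∷ xs → x ≤ y
head≤ _          (here refl)  = ≤-refl
head≤ (x≤xs ∷ _) (there y∈xs) = All.lookup x≤xs y∈xs

sorted-interleaving : ∀ xs {A B} → Sorted xs → Sorted A → Sorted B → A ++ B ↭ xs →
  ∃ λ mask → length mask ≡ length xs × select mask xs ≡ A × select (map not mask) xs ≡ B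
sorted-interleaving [] {[]}    {[]}    _ _ _ _ = [] , refl , refl , refl
sorted-interleaving [] {_ ∷ _} {_}     _ _ _ p with () ← ↭-empty-inv p
sorted-interleaving [] {[]}    {_ ∷ _} _ _ _ p with () ← ↭-empty-inv p
sorted-interleaving (x ∷ xs) {A} {B} sxs sA sB p with ∈-++⁻ A (∈-resp-↭ (↭-sym p) (here refl))
sorted-interleaving (x ∷ xs) {a ∷ A} {B} sxs@(_ ∷ sxs′) sA@(_ ∷ sA′) sB p | inj₁ x∈A
  with refl ← ≤-antisym (head≤ sA x∈A) (head≤ sxs (∈-resp-↭ p (here refl)))
  with mask , l , selA , selB ← sorted-interleaving xs sxs′ sA′ sB (drop-∷ p)
  = true ∷ mask , cong suc l , cong (x ∷_) selA , selB
sorted-interleaving (x ∷ xs) {A} {b ∷ B} sxs@(_ ∷ sxs′) sA sB@(_ ∷ sB′) p | inj₂ x∈B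
  with refl ← ≤-antisym (head≤ sB x∈B) (head≤ sxs (∈-resp-↭ p (∈-++⁺ʳ A (here refl))))
  with mask , l , selA , selB ← sorted-interleaving xs sxs′ sA sB′ (drop-mid A [] p)
  = false ∷ mask , cong suc l , selA , cong (x ∷_) selB

descents-∷ : ∀ x xs → descents xs ≤ descents (x ∷ xs)
descents-∷ x []       = z≤n
descents-∷ x (y ∷ ys) = m≤n+m (descents (y ∷ ys)) _

descents-∷ʳ : ∀ xs x → descents xs ≤ descents (xs ∷ʳ x)
descents-∷ʳ []           _ = z≤n
descents-∷ʳ (_ ∷ [])     _ = z≤n
descents-∷ʳ (y ∷ z ∷ zs) x = +-monoʳ-≤ (if z <ᵇ y then 1 else 0) (descents-∷ʳ (z ∷ zs) x)

descents-descent : ∀ {x y} ys → y < x → descents (x ∷ y ∷ ys) ≡ suc (descents (y ∷ ys))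
descents-descent {x} {y} _ y<x with y <ᵇ x | <⇒<ᵇ y<x
... | true | _ = refl

descents≡0⇒≤ : ∀ {x y} ys → descents (x ∷ y ∷ ys) ≡ 0 → x ≤ y
descents≡0⇒≤ ys d = ≮⇒≥ (λ y<x → 1+n≢0 (trans (sym (descents-descent ys y<x)) d))

descents≡0⇒Linked : ∀ xs → descents xs ≡ 0 → Linked _≤_ xs
descents≡0⇒Linked []           _ = []
descents≡0⇒Linked (x ∷ [])     _ = [-]
descents≡0⇒Linked (x ∷ y ∷ ys) d = descents≡0⇒≤ ys d ∷
  descents≡0⇒Linked (y ∷ ys) (n≤0⇒n≡0 (≤-trans (descents-∷ x (y ∷ ys)) (≤-reflexive d)))

descents≤1⇒runs : ∀ xs → descents xs ≤ 1 →
  ∃₂ λ A B → xs ≡ A ++ B × Linked _≤_ A × Linked _≤_ B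
descents≤1⇒runs []           _ = [] , [] , refl , [] , []
descents≤1⇒runs (x ∷ [])     _ = [ x ] , [] , refl , [-] , []
descents≤1⇒runs (x ∷ y ∷ ys) d
  with descents≤1⇒runs (y ∷ ys) (≤-trans (descents-∷ x (y ∷ ys)) d) | x ≤? y
... | _ | no x≰y = [ x ] , y ∷ ys , refl , [-] ,
  descents≡0⇒Linked (y ∷ ys) (n≤0⇒n≡0 (s≤s⁻¹ (subst (_≤ 1) (descents-descent ys (≰⇒> x≰y)) d)))
... | []    , B , refl , _    , runB | yes x≤y = [ x ] , B , refl , [-] , runB
... | _ ∷ A , B , refl , runA , runB | yes x≤y = x ∷ _ ∷ A , B , refl , x≤y ∷ runA , runB

two-runs⇒DLStep : ∀ {K} pre {frag} suf {τ} → Sorted frag → length frag ≤ K → τ ↭ frag →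
  descents τ ≤ 1 → DLStep K (pre ++ frag ++ suf) (pre ++ τ ++ suf)
two-runs⇒DLStep pre {frag} suf {τ} sorted short τ↭frag d
  with A , B , refl , runA , runB ← descents≤1⇒runs τ d
  with mask , lmask , refl , refl ← sorted-interleaving frag sorted
         (Linked⇒AllPairs ≤-trans runA) (Linked⇒AllPairs ≤-trans runB) τ↭frag
  = pre , frag , suf , mask , refl , short , lmask , cong (pre ++_) (++-assoc A B suf)

head≡just⇒∷ : ∀ {xs : List ℕ} {x} → head xs ≡ just x → ∃ λ ys → xs ≡ x ∷ ys
head≡just⇒∷ {_ ∷ ys} refl = ys , refl

last≡just⇒∷ʳ : ∀ {xs : List ℕ} {x} → last xs ≡ just x → ∃ λ ys → xs ≡ ys ∷ʳ x
last≡just⇒∷ʳ {_ ∷ []}    refl = [] , refl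
last≡just⇒∷ʳ {y ∷ z ∷ zs} eq with ys , z∷zs≡ys∷ʳx ← last≡just⇒∷ʳ {z ∷ zs} eq =
  y ∷ ys , cong (y ∷_) z∷zs≡ys∷ʳx

last-++-∷ : ∀ (xs : List ℕ) y ys → last (xs ++ y ∷ ys) ≡ last (y ∷ ys)
last-++-∷ []           _ _  = refl
last-++-∷ (_ ∷ [])     _ _  = refl
last-++-∷ (_ ∷ x ∷ xs) y ys = last-++-∷ (x ∷ xs) y ys

drop-∷ʳ : ∀ {xs ys : List ℕ} {x} → xs ∷ʳ x ↭ ys ∷ʳ x → xs ↭ ys
drop-∷ʳ {xs} {ys} p = subst₂ _↭_ (++-identityʳ xs) (++-identityʳ ys) (drop-mid xs ys p)

length-identity : ∀ n → length (identity n) ≡ n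
length-identity n = trans (length-map suc (upTo n)) (length-upTo n)

identity-∷ʳ : ∀ n → identity n ∷ʳ suc n ≡ identity (suc n)
identity-∷ʳ n = trans (sym (map-++ suc (upTo n) [ n ])) (cong (map suc) (upTo-∷ʳ n))

last-identity : ∀ n → last (identity (suc n)) ≡ just (suc n)
last-identity n = trans (cong last (sym (identity-∷ʳ n))) (last-++-∷ (identity n) (suc n) [])

identity-sorted : ∀ n → Sorted (identity n)
identity-sorted n = Linked⇒AllPairs ≤-trans (map⁺ (applyUpTo⁺₂ (λ i → i) n (λ i → n≤1+n (suc i))))

DLStep-identity-fixing-head : ∀ K σ → σ ↭ identity (suc K) → descents σ ≤ 1 → head σ ≡ just 1 →
  DLStep K (identity (suc K)) σ
DLStep-identity-fixing-head K σ σ↭id d σ₁≡1 with τ , refl ← head≡just⇒∷ {σ} σ₁≡1 =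
  subst₂ (DLStep K) (cong (1 ∷_) (++-identityʳ _)) (cong (1 ∷_) (++-identityʳ τ))
    (two-runs⇒DLStep [ 1 ] [] (drop⁺ 1 (identity-sorted (suc K)))
      (≤-reflexive (suc-injective (length-identity (suc K))))
      (drop-∷ σ↭id) (≤-trans (descents-∷ 1 τ) d))

DLStep-identity-fixing-last : ∀ K σ → σ ↭ identity (suc K) → descents σ ≤ 1 →
  last σ ≡ just (suc K) → DLStep K (identity (suc K)) σ
DLStep-identity-fixing-last K σ σ↭id d σₙ≡n with τ , refl ← last≡just⇒∷ʳ {σ} σₙ≡n =
  subst (λ π → DLStep K π (τ ∷ʳ suc K)) (identity-∷ʳ K)
    (two-runs⇒DLStep [] [ suc K ] (identity-sorted K) (≤-reflexive (length-identity K))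
      (drop-∷ʳ (subst (τ ∷ʳ suc K ↭_) (sym (identity-∷ʳ K)) σ↭id))
      (≤-trans (descents-∷ʳ τ (suc K)) d))

DLStep-head-or-last : ∀ {K π σ} → DLStep K π σ → K < length π →
  head σ ≡ head π ⊎ last σ ≡ last π
DLStep-head-or-last (_ ∷ _ , _ , _ , _ , refl , _ , _ , refl) _ = inj₁ refl
DLStep-head-or-last ([] , frag , [] , _ , refl , short , _ , refl) long =
  ⊥-elim (≤⇒≯ short (subst (_ <_) (cong length (++-identityʳ frag)) long))
DLStep-head-or-last ([] , frag , s ∷ suf , mask , refl , _ , _ , refl) _ = inj₂ (begin
    last (S ++ S′ ++ s ∷ suf)   ≡⟨ cong last (sym (++-assoc S S′ (s ∷ suf))) ⟩
    last ((S ++ S′) ++ s ∷ suf) ≡⟨ last-++-∷ (S ++ S′) s suf ⟩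
    last (s ∷ suf)              ≡⟨ sym (last-++-∷ frag s suf) ⟩
    last (frag ++ s ∷ suf)      ∎)
  where
  open ≡-Reasoning
  S  = select mask frag
  S′ = select (map not mask) frag

proposition1 : (K : ℕ) → 2 ≤ K → (σ : List ℕ) → σ ↭ identity (suc K) → descents σ ≡ 1 →
    ((¬ InC K σ) ⇔ ((head σ ≢ just 1) × (last σ ≢ just (suc K))))
proposition1 K _ σ σ↭id one-descent = mk⇔
  (λ σ∉C → σ∉C ∘ fromStep ∘ DLStep-identity-fixing-head K σ σ↭id d≤1
         , σ∉C ∘ fromStep ∘ DLStep-identity-fixing-last K σ σ↭id d≤1)
  (λ (σ₁≢1 , σₙ≢n) σ∈C →
    case DLStep-head-or-last (toStep σ∈C) (≤-reflexive (sym (length-identity (suc K)))) of λ where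
      (inj₁ σ₁≡1) → σ₁≢1 σ₁≡1
      (inj₂ σₙ≡πₙ) → σₙ≢n (trans σₙ≡πₙ (last-identity K)))
  where
  d≤1 : descents σ ≤ 1
  d≤1 = ≤-reflexive one-descent
  length-σ : length σ ≡ suc K
  length-σ = trans (↭-length σ↭id) (length-identity (suc K))
  toStep : InC K σ → DLStep K (identity (suc K)) σ
  toStep = subst (λ n → DLStep K (identity n) σ) length-σ
  fromStep : DLStep K (identity (suc K)) σ → InC K σ
  fromStep = subst (λ n → DLStep K (identity n) σ) (sym length-σ)
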